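{- Let $x\in\mathrm{Weak}(B_n)$ satisfy $|\mathscr{U}_{\mathrm{Weak}(B_n)}(x)|=n-1$. If some value $j\ge n+1$ occurs in $x$ at a position $\mathrm{ind}_x(j)\le n$, then $j$ lies in $\mathrm{asc}_1(x)$.
   Context: $B_n$ is the set of permutations $x=x_1\cdots x_{2n}$ of $\{1,\dots,2n\}$ with $x_i+x_{2n+1-i}=2n+1$ for all $i$; $\mathrm{Weak}(B_n)$ is $B_n$ with the right weak order. $\mathscr{U}_{\mathrm{Weak}(B_n)}(x)$ is the set of elements covering $x$, and $|\mathscr{U}_{\mathrm{Weak}(B_n)}(x)|=\#\{i\in\{1,\dots,n\}:x_i<x_{i+1}\}$. $\mathrm{ind}_x(a)$ is the position of the value $a$ in $x$, and $\mathrm{asc}_1(x)$ is the first (leftmost) maximal ascending run (maximal consecutive increasing substring) of $x$. -}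

module Defs where

open import Data.Nat using (ℕ; zero; suc; _+_; _*_; _∸_; _≤_; _<_; _<ᵇ_)
open import Data.Bool using (Bool; true; false; if_then_else_)
open import Data.Fin using (Fin; toℕ; opposite)
open import Data.List using (List; []; _∷_; length; filter; upTo)
open import Data.List.Membership.Propositional using (_∈_)
open import Data.Product using (_×_)
open import Relation.Binary.PropositionalEquality using (_≡_)
open import Function.Definitions using (Injective)
open import Data.Nat.Properties using (_<?_)

Word : ℕ → Set
Word n = Fin (2 * n) → ℕ

-- x ∈ B_n : x is a permutation of {1,…,2n} (injective with values in [1,2n])
-- and x_i + x_{2n+1-i} = 2n+1 (0-based: x i + x (opposite i) = 2n+1).
IsBn : (n : ℕ) → Word n → Set
IsBn n x = Injective _≡_ _≡_ x
         × (∀ i → 1 ≤ x i × x i ≤ 2 * n)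
         × (∀ i → x i + x (opposite i) ≡ suc (2 * n))

-- value at 1-based position k (0 if out of range)
at : ∀ {m} → (Fin m → ℕ) → ℕ → ℕ
at {zero}  x k             = 0
at {suc m} x zero          = 0
at {suc m} x (suc zero)    = x Fin.zero
at {suc m} x (suc (suc k)) = at (λ i → x (Fin.suc i)) (suc k)

-- |U_{Weak(B_n)}(x)| = #{ i ∈ {1,…,n} : x_i < x_{i+1} }
upCount : (n : ℕ) → Word n → ℕ
upCount n x = length (filter (λ i → at x i <? at x (suc i)) (Data.List.map suc (upTo n)))

toList : ∀ {m} → (Fin m → ℕ) → List ℕ
toList {zero}  x = []
toList {suc m} x = x Fin.zero ∷ toList (λ i → x (Fin.suc i))

firstRun : List ℕ → List ℕ
firstRun []           = []
firstRun (a ∷ [])     = a ∷ []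
firstRun (a ∷ b ∷ l)  = if a <ᵇ b then a ∷ firstRun (b ∷ l) else a ∷ []

asc₁ : ∀ {n} → Word n → List ℕ
asc₁ x = firstRun (toList x)

{-# OPTIONS --safe #-}
-- Among positions 1, …, n there is exactly one descent. If it came before the position p of j,
-- x would ascend from p up to the middle, so j ≤ x_n < x_{n+1}; but x_n + x_{n+1} = 2n+1 then
-- forces x_n ≤ n < j. Hence x_1 < ⋯ < x_p, and j lies in the first ascending run.
module Submission where

open import Defs
open import Level using (Level)
open import Data.Nat using (ℕ; zero; suc; _+_; _*_; _∸_; _≤_; _<_; _<ᵇ_; z≤n; s≤s)
open import Data.Nat.Properties
open import Data.Fin using (Fin; toℕ; fromℕ<; opposite)
open import Data.Fin.Properties using (toℕ-fromℕ<; opposite-prop; toℕ<n)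
open import Data.List using (_∷_; length; filter; upTo; map)
open import Data.List.Properties using (length-map; length-upTo; filter-reject; filter-notAll)
open import Data.List.Membership.Propositional using (_∈_; lose)
open import Data.List.Membership.Propositional.Properties using (∈-map⁺; ∈-upTo⁺)
open import Data.List.Relation.Unary.Any using (here; there)
open import Data.Bool using (true; false; T)
open import Data.Product using (_,_)
open import Data.Sum using (inj₁; inj₂)
open import Data.Empty using (⊥-elim)
open import Relation.Nullary using (¬_; yes; no)
open import Relation.Unary using (Pred; Decidable)
open import Relation.Binary.PropositionalEquality
open import Function using (_∘_)

module _ {a p : Level} {A : Set a} {P : Pred A p} (P? : Decidable P) where

  length-filter-∷ : ∀ y ys → length (filter P? (y ∷ ys)) ≤ suc (length (filter P? ys))
  length-filter-∷ y ys with P? y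
  ... | yes _ = ≤-refl
  ... | no  _ = n≤1+n _

  filter-rejects-two : ∀ {u v xs} → u ≢ v → u ∈ xs → v ∈ xs → ¬ P u → ¬ P v →
                       2 + length (filter P? xs) ≤ length xs
  filter-rejects-two u≢v (here refl) (here refl) _ _ = ⊥-elim (u≢v refl)
  filter-rejects-two {xs = _ ∷ ys} _ (here refl) (there v∈) ¬Pu ¬Pv
    rewrite filter-reject P? {xs = ys} ¬Pu = s≤s (filter-notAll P? ys (lose v∈ ¬Pv))
  filter-rejects-two {xs = _ ∷ ys} _ (there u∈) (here refl) ¬Pu ¬Pv
    rewrite filter-reject P? {xs = ys} ¬Pv = s≤s (filter-notAll P? ys (lose u∈ ¬Pu))
  filter-rejects-two {xs = y ∷ ys} u≢v (there u∈) (there v∈) ¬Pu ¬Pv =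
    ≤-trans (s≤s (s≤s (length-filter-∷ y ys))) (s≤s (filter-rejects-two u≢v u∈ v∈ ¬Pu ¬Pv))

ascending-≤ : (f : ℕ → ℕ) {a b : ℕ} → a ≤ b →
              (∀ k → a ≤ k → k < b → f k < f (suc k)) → f a ≤ f b
ascending-≤ f {b = zero} z≤n _ = ≤-refl
ascending-≤ f {a} {suc b} a≤1+b asc with m≤n⇒m<n∨m≡n a≤1+b
... | inj₂ refl = ≤-refl
... | inj₁ (s≤s a≤b) =
  ≤-trans (ascending-≤ f a≤b (λ k a≤k k<b → asc k a≤k (m<n⇒m<1+n k<b)))
          (<⇒≤ (asc b a≤b ≤-refl))

smaller-of-pair-summing-to-odd : ∀ {a b} n → a < b → a + b ≡ suc (2 * n) → a ≤ n
smaller-of-pair-summing-to-odd {a} {b} n a<b a+b≡2n+1 = *-cancelˡ-≤ 2 (≤-pred 2a<2n+1)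
  where
  2a<2n+1 : 2 * a < suc (2 * n)
  2a<2n+1 = subst (2 * a <_) a+b≡2n+1 (+-monoʳ-< a (subst (_< b) (sym (+-identityʳ a)) a<b))

Ascent : ∀ {m} → (Fin m → ℕ) → ℕ → Set
Ascent x i = at x i < at x (suc i)

at-suc-toℕ : ∀ {m} (x : Fin m → ℕ) (i : Fin m) → at x (suc (toℕ i)) ≡ x i
at-suc-toℕ {suc m} x Fin.zero    = refl
at-suc-toℕ {suc m} x (Fin.suc i) = at-suc-toℕ (λ k → x (Fin.suc k)) i

at-∈-firstRun : ∀ {m} (x : Fin m → ℕ) k → k < m →
                (∀ i → i < k → Ascent x (suc i)) → at x (suc k) ∈ firstRun (toList x)
at-∈-firstRun {suc zero}    x zero    _ _ = here refl
at-∈-firstRun {suc zero}    x (suc k) (s≤s ()) _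
at-∈-firstRun {suc (suc m)} x zero    _ _ with x Fin.zero <ᵇ x (Fin.suc Fin.zero)
... | true  = here refl
... | false = here refl
at-∈-firstRun {suc (suc m)} x (suc k) (s≤s k<m) asc
  with x Fin.zero <ᵇ x (Fin.suc Fin.zero) in x₁<ᵇx₂
... | true  = there (at-∈-firstRun (λ i → x (Fin.suc i)) k k<m (λ i i<k → asc (suc i) (s≤s i<k)))
... | false with () ← subst T x₁<ᵇx₂ (<⇒<ᵇ (asc zero (s≤s z≤n)))

Symmetric : (n : ℕ) → Word n → Set
Symmetric n x = ∀ i → x i + x (opposite i) ≡ suc (2 * n)

middle-sum : ∀ m (x : Word (suc m)) → Symmetric (suc m) x →
             at x (suc m) + at x (suc (suc m)) ≡ suc (2 * suc m)
middle-sum m x symmetric = begin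
  at x (suc m) + at x (suc (suc m))  ≡⟨ cong₂ _+_ (at-at i toℕi≡m) (at-at (opposite i) toℕ-opposite-i) ⟩
  x i + x (opposite i)               ≡⟨ symmetric i ⟩
  suc (2 * suc m)                    ∎
  where
  open ≡-Reasoning
  m<2[1+m] : m < 2 * suc m
  m<2[1+m] = s≤s (m≤m+n m _)
  i : Fin (2 * suc m)
  i = fromℕ< m<2[1+m]
  toℕi≡m : toℕ i ≡ m
  toℕi≡m = toℕ-fromℕ< m<2[1+m]
  toℕ-opposite-i : toℕ (opposite i) ≡ suc m
  toℕ-opposite-i = begin
    toℕ (opposite i)              ≡⟨ opposite-prop i ⟩
    2 * suc m ∸ suc (toℕ i)       ≡⟨ cong (λ t → 2 * suc m ∸ suc t) toℕi≡m ⟩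
    suc m + (suc m + 0) ∸ suc m   ≡⟨ m+n∸m≡n (suc m) (suc m + 0) ⟩
    suc m + 0                     ≡⟨ +-identityʳ (suc m) ⟩
    suc m                         ∎
  at-at : ∀ j {k} → toℕ j ≡ k → at x (suc k) ≡ x j
  at-at j refl = at-suc-toℕ x j

ascending-to-middle⇒≤n : ∀ n (x : Word n) → Symmetric n x → ∀ q → q < n →
                         (∀ k → q ≤ k → k < n → Ascent x (suc k)) → at x (suc q) ≤ n
ascending-to-middle⇒≤n (suc m) x symmetric q q<n asc =
  ≤-trans (ascending-≤ (at x) q<n ascent-below-middle)
          (smaller-of-pair-summing-to-odd (suc m) (asc m (≤-pred q<n) ≤-refl) (middle-sum m x symmetric))
  where
  ascent-below-middle : ∀ k → suc q ≤ k → k < suc m → Ascent x k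
  ascent-below-middle (suc k) (s≤s q≤k) 1+k<1+m = asc k q≤k (≤-trans (n≤1+n _) 1+k<1+m)

descent-unique : ∀ n (x : Word n) → upCount n x ≡ n ∸ 1 → ∀ {d e} → d < n → e < n →
                 ¬ Ascent x (suc d) → ¬ Ascent x (suc e) → d ≡ e
descent-unique (suc m) x one-descent {d} {e} d<n e<n ¬asc-d ¬asc-e with d ≟ e
... | yes d≡e = d≡e
... | no  d≢e = ⊥-elim (1+n≰n (≤-pred too-many))
  where
  too-many : 2 + m ≤ suc m
  too-many = subst₂ (λ c l → 2 + c ≤ l) one-descent
    (trans (length-map suc (upTo (suc m))) (length-upTo (suc m)))
    (filter-rejects-two (λ i → at x i <? at x (suc i)) (d≢e ∘ suc-injective)
      (∈-map⁺ suc (∈-upTo⁺ d<n)) (∈-map⁺ suc (∈-upTo⁺ e<n)) ¬asc-d ¬asc-e)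

mainTheorem7 : (n : ℕ) (x : Word n) → IsBn n x → upCount n x ≡ n ∸ 1 →
               (j : ℕ) → suc n ≤ j → (p : Fin (2 * n)) → x p ≡ j →
               suc (toℕ p) ≤ n → j ∈ asc₁ {n} x
mainTheorem7 n x (_ , _ , symmetric) one-descent j n<j p xp≡j p<n =
  subst (_∈ asc₁ {n} x) at-p≡j (at-∈-firstRun x (toℕ p) (toℕ<n p) no-descent-before-p)
  where
  at-p≡j : at x (suc (toℕ p)) ≡ j
  at-p≡j = trans (at-suc-toℕ x p) xp≡j
  no-descent-before-p : ∀ i → i < toℕ p → Ascent x (suc i)
  no-descent-before-p i i<p with at x (suc i) <? at x (suc (suc i))
  ... | yes ascent = ascent
  ... | no descent = ⊥-elim (<⇒≱ n<j (subst (_≤ n) at-p≡j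
          (ascending-to-middle⇒≤n n x symmetric (toℕ p) p<n ascent-after-p)))
    where
    ascent-after-p : ∀ k → toℕ p ≤ k → k < n → Ascent x (suc k)
    ascent-after-p k p≤k k<n with at x (suc k) <? at x (suc (suc k))
    ... | yes ascent = ascent
    ... | no descent′ = ⊥-elim (<⇒≢ (<-≤-trans i<p p≤k)
            (descent-unique n x one-descent (<-trans i<p p<n) k<n descent descent′))
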